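{- The integrality gap of $\mathrm{SER}$ and of $\mathrm{SER}^+$ for $(1,2)$-ATSP is at least $6/5$; that is, there is an instance $G$ of $(1,2)$-ATSP with $\mathrm{Opt}(G)/\mathrm{Opt}_{\mathrm{SER}}(G)\ge 6/5$ and $\mathrm{Opt}(G)/\mathrm{Opt}_{\mathrm{SER}^+}(G)\ge 6/5$.
   Context: An instance $G$ of $(1,2)$-ATSP is a complete directed graph without loops on a finite vertex set, with arc costs in $\{1,2\}$; $\mathrm{Opt}(G)$ is the minimum cost of a directed Hamiltonian cycle. For $S\subseteq V(G)$, $\delta^+(S)$ and $\delta^-(S)$ are the sets of arcs leaving and entering $S$, $x(F)=\sum_{e\in F}x_e$. $\mathrm{SER}(G)$ is the polytope of $x\in\mathbb{R}^{E(G)}$ with $x(\delta^-(v))=x(\delta^+(v))=1$ for all $v$, $x(\delta^-(S))\ge1$, $x(\delta^+(S))\ge1$ for all $\emptyset\ne S\subsetneq V(G)$, $x\ge0$; $\mathrm{Opt}_{\mathrm{SER}}(G)$ is the minimum of $\sum_e\mathrm{cost}(e)x_e$ over it. $\mathrm{SER}^+(G)$ adds the constraint $\sum_e\mathrm{cost}(e)x_e\ge\lceil\mathrm{Opt}_{\mathrm{SER}}(G)\rceil$, with optimal value $\mathrm{Opt}_{\mathrm{SER}^+}(G)$. The integrality gap of a relaxation is the supremum over instances of $\mathrm{Opt}(G)$ divided by the optimal value of the relaxation. -}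

module Defs where

open import Data.Nat as ℕ using (ℕ; zero; suc)
open import Data.Integer using (+_)
open import Data.Fin using (Fin; zero; suc; _≟_)
open import Data.Fin.Subset using (Subset; _∈_; _∉_)
open import Data.Vec using (lookup)
open import Data.Bool using (Bool; true; false; if_then_else_; _∧_; not)
open import Data.Rational using (ℚ; 0ℚ; _+_; _*_; _≤_; _<_; _-_; 1ℚ; _/_)
open import Data.Product using (Σ; ∃; _×_; _,_)
open import Data.Sum using (_⊎_)
open import Relation.Binary.PropositionalEquality using (_≡_; _≢_)
open import Relation.Nullary.Decidable using (⌊_⌋)
open import Function using (Injective)

ℕ→ℚ : ℕ → ℚ
ℕ→ℚ k = + k / 1

ΣFin : ∀ {n} → (Fin n → ℚ) → ℚ
ΣFin {zero}  f = 0ℚ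
ΣFin {suc n} f = f zero + ΣFin (λ i → f (suc i))

ΣFinℕ : ∀ {n} → (Fin n → ℕ) → ℕ
ΣFinℕ {zero}  f = 0
ΣFinℕ {suc n} f = f zero ℕ.+ ΣFinℕ (λ i → f (suc i))

-- An instance of (1,2)-ATSP: complete digraph without loops on Fin n,
-- arc (i , j) with i ≢ j has cost ∈ {1,2}; cost on the diagonal is irrelevant.
record Instance : Set where
  field
    n     : ℕ
    cost  : Fin n → Fin n → ℕ
    cost12 : ∀ i j → i ≢ j → (cost i j ≡ 1) ⊎ (cost i j ≡ 2)
open Instance public

isArc : ∀ {n} → Fin n → Fin n → Bool
isArc i j = not ⌊ i ≟ j ⌋

arcSum : ∀ {n} → (Fin n → Fin n → Bool) → (Fin n → Fin n → ℚ) → ℚ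
arcSum P x = ΣFin (λ i → ΣFin (λ j → if isArc i j ∧ P i j then x i j else 0ℚ))

mem : ∀ {n} → Fin n → Subset n → Bool
mem i S = lookup S i

outOf : ∀ {n} → Subset n → (Fin n → Fin n → ℚ) → ℚ
outOf S = arcSum (λ i j → mem i S ∧ not (mem j S))

into : ∀ {n} → Subset n → (Fin n → Fin n → ℚ) → ℚ
into S = arcSum (λ i j → not (mem i S) ∧ mem j S)

outV : ∀ {n} → Fin n → (Fin n → Fin n → ℚ) → ℚ
outV v = arcSum (λ i j → ⌊ i ≟ v ⌋)

inV : ∀ {n} → Fin n → (Fin n → Fin n → ℚ) → ℚ
inV v = arcSum (λ i j → ⌊ j ≟ v ⌋)

lpCost : (G : Instance) → (Fin (n G) → Fin (n G) → ℚ) → ℚ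
lpCost G x = arcSum (λ _ _ → true) (λ i j → ℕ→ℚ (cost G i j) * x i j)

-- x ∈ SER(G)   (x indexed by ordered pairs; only arcs i ≢ j matter)
InSER : (G : Instance) → (Fin (n G) → Fin (n G) → ℚ) → Set
InSER G x =
    (∀ v → inV v x ≡ 1ℚ)
  × (∀ v → outV v x ≡ 1ℚ)
  × (∀ (S : Subset (n G)) → (∃ λ i → i ∈ S) → (∃ λ j → j ∉ S) →
        (1ℚ ≤ into S x) × (1ℚ ≤ outOf S x))
  × (∀ i j → i ≢ j → 0ℚ ≤ x i j)

IsCeilOptSER : (G : Instance) → ℕ → Set
IsCeilOptSER G k =
    (∃ λ y → InSER G y × (lpCost G y ≤ ℕ→ℚ k))
  × (∀ y → InSER G y → ℕ→ℚ k - 1ℚ < lpCost G y)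

InSER⁺ : (G : Instance) → (Fin (n G) → Fin (n G) → ℚ) → Set
InSER⁺ G x = InSER G x × (∀ k → IsCeilOptSER G k → ℕ→ℚ k ≤ lpCost G x)

iter : ∀ {A : Set} → (A → A) → ℕ → A → A
iter f zero    a = a
iter f (suc k) a = f (iter f k a)

IsHamCycle : ∀ {n} → (Fin n → Fin n) → Set
IsHamCycle {n} s =
    Injective _≡_ _≡_ s
  × (∀ i → s i ≢ i)
  × (∀ i j → ∃ λ k → iter s k i ≡ j)

tourCost : (G : Instance) → (Fin (n G) → Fin (n G)) → ℕ
tourCost G s = ΣFinℕ (λ i → cost G i (s i))

OptAtLeast : (G : Instance) → ℕ → Set
OptAtLeast G C = ∀ s → IsHamCycle s → C ℕ.≤ tourCost G s

-- The cost-1 arcs of G₅ are exactly the arcs of the two cycle covers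
-- σ₁ = (0 1)(2 4 3) and σ₂ = (0 2)(1 3 4).  Their average x₅ satisfies every
-- subtour-elimination constraint and costs 5; as 5 is an integer, x₅ also meets
-- the extra SER⁺ constraint (cost ≥ ⌈Opt_SER⌉ ≤ 5).  A tour of cost 5 would use
-- only cost-1 arcs, i.e. follow σ₁ or σ₂ at each vertex; each of these 32
-- successor functions has a proper closed subset, so none is a Hamiltonian
-- cycle, and every tour costs at least 6.

module Submission where

open import Defs
open import Data.Nat using (ℕ; _≤_)
open import Data.Product using (Σ; ∃; _×_)
open import Data.Rational using (_*_; _≤_)

open import Data.Bool using (Bool; true; false; if_then_else_; _∨_)
open import Data.Empty using (⊥-elim)
open import Data.Fin using (Fin; zero; suc; #_)
import Data.Fin as Fin
open import Data.Fin.Properties using (all?; any?; ¬∀⟶∃¬)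
open import Data.Fin.Subset using (Subset; _∈_; _∉_)
open import Data.Fin.Subset.Properties using (_∈?_; anySubset?)
import Data.Integer as ℤ
import Data.Integer.Properties as ℤₚ
import Data.Nat as ℕ
import Data.Nat.Coprimality as Coprime
import Data.Nat.Properties as ℕₚ
open import Data.Product using (_,_)
open import Data.Rational as ℚ using (ℚ; mkℚ; ½; 0ℚ; 1ℚ; _-_)
import Data.Rational.Properties as ℚₚ
open import Data.Sum using (_⊎_; inj₁; inj₂)
open import Data.Vec using ([]; _∷_; lookup; tabulate)
open import Data.Vec.Properties using (lookup∘tabulate)
open import Function using (_∘_)
open import Relation.Binary.PropositionalEquality
open import Relation.Nullary using (Dec; yes; no; ¬_; contradiction)
open import Relation.Nullary.Decidable
  using (⌊_⌋; from-yes; decidable-stable; ¬?; _×-dec_; _→-dec_; map′)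
open import Relation.Unary using (Pred; Decidable)

ℕ→ℚ≡mkℚ : ∀ k → ℕ→ℚ k ≡ mkℚ (ℤ.+ k) 0 (Coprime.sym (Coprime.1-coprimeTo k))
ℕ→ℚ≡mkℚ k = ℚₚ.normalize-coprime (Coprime.sym (Coprime.1-coprimeTo k))

ℕ→ℚ-mono-≤ : ∀ {j k} → j ℕ.≤ k → ℕ→ℚ j ℚ.≤ ℕ→ℚ k
ℕ→ℚ-mono-≤ {j} {k} j≤k rewrite ℕ→ℚ≡mkℚ j | ℕ→ℚ≡mkℚ k =
  ℚ.*≤* (subst₂ ℤ._≤_ (sym (ℤₚ.*-identityʳ (ℤ.+ j))) (sym (ℤₚ.*-identityʳ (ℤ.+ k))) (ℤ.+≤+ j≤k))

ℕ→ℚ-suc-∸1 : ∀ k → ℕ→ℚ (ℕ.suc k) - 1ℚ ≡ ℕ→ℚ k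
ℕ→ℚ-suc-∸1 k rewrite ℕ→ℚ≡mkℚ (ℕ.suc k) | ℕₚ.*-identityʳ k = refl

allSubset? : ∀ {n ℓ} {P : Pred (Subset n) ℓ} → Decidable P → Dec (∀ S → P S)
allSubset? P? = map′
  (λ ¬counter S → decidable-stable (P? S) (λ ¬PS → ¬counter (S , ¬PS)))
  (λ ∀P (S , ¬PS) → ¬PS (∀P S))
  (¬? (anySubset? (λ S → ¬? (P? S))))

inSER? : (G : Instance) (x : Fin (n G) → Fin (n G) → ℚ) → Dec (InSER G x)
inSER? G x =
      all? (λ v → inV v x ℚₚ.≟ 1ℚ)
  ×-dec all? (λ v → outV v x ℚₚ.≟ 1ℚ)
  ×-dec allSubset? (λ S → any? (_∈? S) →-dec any? (λ j → ¬? (j ∈? S))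
                            →-dec (1ℚ ℚₚ.≤? into S x) ×-dec (1ℚ ℚₚ.≤? outOf S x))
  ×-dec all? (λ i → all? (λ j → ¬? (i Fin.≟ j) →-dec 0ℚ ℚₚ.≤? x i j))

ceilOptSER≤integralCost : ∀ G x m → InSER G x → lpCost G x ≡ ℕ→ℚ m →
                          ∀ k → IsCeilOptSER G k → k ℕ.≤ m
ceilOptSER≤integralCost G x m x∈SER cost≡m k (_ , below) with k ℕ.≤? m
... | yes k≤m = k≤m
... | no k≰m = ⊥-elim (ℚₚ.<-irrefl refl (ℚₚ.≤-<-trans m≤k-1 (below x x∈SER)))
  where
  m≤k-1 : lpCost G x ℚ.≤ ℕ→ℚ k - 1ℚ
  m≤k-1 = begin
    lpCost G x              ≡⟨ cost≡m ⟩
    ℕ→ℚ m                   ≡⟨ sym (ℕ→ℚ-suc-∸1 m) ⟩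
    ℕ→ℚ (ℕ.suc m) - 1ℚ      ≤⟨ ℚₚ.+-monoˡ-≤ (ℚ.- 1ℚ) (ℕ→ℚ-mono-≤ (ℕₚ.≰⇒> k≰m)) ⟩
    ℕ→ℚ k - 1ℚ              ∎
    where open ℚₚ.≤-Reasoning

integralSER⇒SER⁺ : ∀ G x m → InSER G x → lpCost G x ≡ ℕ→ℚ m → InSER⁺ G x
integralSER⇒SER⁺ G x m x∈SER cost≡m = x∈SER , λ k ceil →
  subst (ℕ→ℚ k ℚ.≤_) (sym cost≡m)
        (ℕ→ℚ-mono-≤ (ceilOptSER≤integralCost G x m x∈SER cost≡m k ceil))

ΣFinℕ-≥-size : ∀ {k} (f : Fin k → ℕ) → (∀ i → 1 ℕ.≤ f i) → k ℕ.≤ ΣFinℕ f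
ΣFinℕ-≥-size {ℕ.zero}  f f≥1 = ℕ.z≤n
ΣFinℕ-≥-size {ℕ.suc k} f f≥1 = ℕₚ.+-mono-≤ (f≥1 zero) (ΣFinℕ-≥-size (f ∘ suc) (f≥1 ∘ suc))

ΣFinℕ-≥-suc-size : ∀ {k} (f : Fin k → ℕ) → (∀ i → 1 ℕ.≤ f i) →
                   ∀ i → 2 ℕ.≤ f i → ℕ.suc k ℕ.≤ ΣFinℕ f
ΣFinℕ-≥-suc-size f f≥1 zero    fi≥2 = ℕₚ.+-mono-≤ fi≥2 (ΣFinℕ-≥-size (f ∘ suc) (f≥1 ∘ suc))
ΣFinℕ-≥-suc-size f f≥1 (suc i) fi≥2 =
  ℕₚ.+-mono-≤ (f≥1 zero) (ΣFinℕ-≥-suc-size (f ∘ suc) (f≥1 ∘ suc) i fi≥2)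

arcCost≥1 : ∀ G i j → i ≢ j → 1 ℕ.≤ cost G i j
arcCost≥1 G i j i≢j with cost12 G i j i≢j
... | inj₁ c≡1 = ℕₚ.≤-reflexive (sym c≡1)
... | inj₂ c≡2 = ℕₚ.≤-trans (ℕ.s≤s ℕ.z≤n) (ℕₚ.≤-reflexive (sym c≡2))

tourCost≥suc-n : ∀ G {s} → IsHamCycle s → ∀ i → cost G i (s i) ≢ 1 → ℕ.suc (n G) ℕ.≤ tourCost G s
tourCost≥suc-n G {s} (_ , noLoop , _) i c≢1 =
  ΣFinℕ-≥-suc-size (λ j → cost G j (s j)) (λ j → arcCost≥1 G j (s j) (noLoop j ∘ sym)) i c≥2
  where
  c≥2 : 2 ℕ.≤ cost G i (s i)
  c≥2 with cost12 G i (s i) (noLoop i ∘ sym)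
  ... | inj₁ c≡1 = contradiction c≡1 c≢1
  ... | inj₂ c≡2 = ℕₚ.≤-reflexive (sym c≡2)

noUnitCostHamCycle⇒OptAtLeast : ∀ G → (∀ s → IsHamCycle s → ¬ (∀ i → cost G i (s i) ≡ 1)) →
                                OptAtLeast G (ℕ.suc (n G))
noUnitCostHamCycle⇒OptAtLeast G noUnit s ham
  with ¬∀⟶∃¬ (n G) _ (λ i → cost G i (s i) ℕ.≟ 1) (noUnit s ham)
... | i , c≢1 = tourCost≥suc-n G ham i c≢1

Closed : ∀ {k} → (Fin k → Fin k) → Subset k → Set
Closed s P = ∀ i → i ∈ P → s i ∈ P

HasProperClosedSet : ∀ {k} → (Fin k → Fin k) → Set
HasProperClosedSet s = ∃ λ P → Closed s P × (∃ λ a → a ∈ P) × (∃ λ b → b ∉ P)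

hasProperClosedSet? : ∀ {k} (s : Fin k → Fin k) → Dec (HasProperClosedSet s)
hasProperClosedSet? s = anySubset? λ P →
        all? (λ i → i ∈? P →-dec s i ∈? P)
  ×-dec any? (_∈? P)
  ×-dec any? (λ b → ¬? (b ∈? P))

iter-closed : ∀ {k} {s : Fin k → Fin k} {P a} → Closed s P → a ∈ P → ∀ j → iter s j a ∈ P
iter-closed closed a∈P ℕ.zero    = a∈P
iter-closed closed a∈P (ℕ.suc j) = closed _ (iter-closed closed a∈P j)

hasProperClosedSet⇒¬IsHamCycle : ∀ {k} {s : Fin k → Fin k} → HasProperClosedSet s → ¬ IsHamCycle s
hasProperClosedSet⇒¬IsHamCycle (P , closed , (a , a∈P) , (b , b∉P)) (_ , _ , reach)
  with reach a b
... | j , sʲa≡b = b∉P (subst (_∈ P) sʲa≡b (iter-closed closed a∈P j))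

hasProperClosedSet-resp-≗ : ∀ {k} {s t : Fin k → Fin k} → s ≗ t →
                            HasProperClosedSet t → HasProperClosedSet s
hasProperClosedSet-resp-≗ s≗t (P , closed , a∈ , b∉) =
  P , (λ i i∈P → subst (_∈ P) (sym (s≗t i)) (closed i i∈P)) , a∈ , b∉

mix : ∀ {k} → (Fin k → Fin k) → (Fin k → Fin k) → Subset k → Fin k → Fin k
mix σ τ choice i = if lookup choice i then σ i else τ i

choiceOf : ∀ {k} → (Fin k → Fin k) → (Fin k → Fin k) → Subset k
choiceOf σ s = tabulate λ i → ⌊ s i Fin.≟ σ i ⌋

≗-mix : ∀ {k} (σ τ s : Fin k → Fin k) → (∀ i → s i ≡ σ i ⊎ s i ≡ τ i) →
        s ≗ mix σ τ (choiceOf σ s)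
≗-mix σ τ s σ-or-τ i rewrite lookup∘tabulate (λ i → ⌊ s i Fin.≟ σ i ⌋) i
  with s i Fin.≟ σ i | σ-or-τ i
... | yes si≡σi | _         = si≡σi
... | no  si≢σi | inj₁ si≡σi = contradiction si≡σi si≢σi
... | no  _     | inj₂ si≡τi = si≡τi

σ₁ σ₂ : Fin 5 → Fin 5
σ₁ = lookup (# 1 ∷ # 0 ∷ # 4 ∷ # 2 ∷ # 3 ∷ [])
σ₂ = lookup (# 2 ∷ # 3 ∷ # 0 ∷ # 4 ∷ # 1 ∷ [])

isUnitArc : Fin 5 → Fin 5 → Bool
isUnitArc i j = ⌊ j Fin.≟ σ₁ i ⌋ ∨ ⌊ j Fin.≟ σ₂ i ⌋

cost₅ : Fin 5 → Fin 5 → ℕ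
cost₅ i j = if isUnitArc i j then 1 else 2

cost₅∈12 : ∀ i j → i ≢ j → cost₅ i j ≡ 1 ⊎ cost₅ i j ≡ 2
cost₅∈12 i j _ with isUnitArc i j
... | true  = inj₁ refl
... | false = inj₂ refl

G₅ : Instance
G₅ = record { n = 5 ; cost = cost₅ ; cost12 = cost₅∈12 }

x₅ : Fin 5 → Fin 5 → ℚ
x₅ i j = if isUnitArc i j then ½ else 0ℚ

unitArc⇒σ₁∨σ₂ : ∀ i j → cost₅ i j ≡ 1 → j ≡ σ₁ i ⊎ j ≡ σ₂ i
unitArc⇒σ₁∨σ₂ i j c≡1 with j Fin.≟ σ₁ i | j Fin.≟ σ₂ i
... | yes j≡σ₁i | _         = inj₁ j≡σ₁i
... | no _      | yes j≡σ₂i = inj₂ j≡σ₂i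
... | no _      | no _      with () ← c≡1

everyMixHasProperClosedSet : ∀ choice → HasProperClosedSet (mix σ₁ σ₂ choice)
everyMixHasProperClosedSet = from-yes (allSubset? λ choice → hasProperClosedSet? (mix σ₁ σ₂ choice))

opt₅≥6 : OptAtLeast G₅ 6
opt₅≥6 = noUnitCostHamCycle⇒OptAtLeast G₅ λ s ham allUnit →
  hasProperClosedSet⇒¬IsHamCycle
    (hasProperClosedSet-resp-≗ (≗-mix σ₁ σ₂ s (λ i → unitArc⇒σ₁∨σ₂ i (s i) (allUnit i)))
                               (everyMixHasProperClosedSet (choiceOf σ₁ s)))
    ham

x₅∈SER : InSER G₅ x₅
x₅∈SER = from-yes (inSER? G₅ x₅)

lpCost-x₅ : lpCost G₅ x₅ ≡ ℕ→ℚ 5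
lpCost-x₅ = refl

theorem1 : Σ Instance λ G → (2 Data.Nat.≤ n G) × Σ ℕ λ C → OptAtLeast G C
    × (∃ λ x → InSER G x × (ℕ→ℚ 6 * lpCost G x Data.Rational.≤ ℕ→ℚ 5 * ℕ→ℚ C))
    × (∃ λ x → InSER⁺ G x × (ℕ→ℚ 6 * lpCost G x Data.Rational.≤ ℕ→ℚ 5 * ℕ→ℚ C))
theorem1 = G₅ , ℕ.s≤s (ℕ.s≤s ℕ.z≤n) , 6 , opt₅≥6
         , (x₅ , x₅∈SER , ratio≤)
         , (x₅ , integralSER⇒SER⁺ G₅ x₅ 5 x₅∈SER lpCost-x₅ , ratio≤)
  where
  ratio≤ : ℕ→ℚ 6 * lpCost G₅ x₅ ℚ.≤ ℕ→ℚ 5 * ℕ→ℚ 6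
  ratio≤ = ℚₚ.≤-refl
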